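{- Let $A$ be a query game, $\mathbf{B}$ a set of query games and $T>0$. If $A$ has a bounded reduction of weight at most $T$ to $\mathbf{B}$, then for every $r\in\mathcal{R}$, $A$ has an $r(t)$-bounded reduction to $\mathbf{B}$ of length at most $4T$.
   Context: A query game is a pair $A=(Q,\mathcal{F})$ where $Q$ contains a distinguished zero-query $0$ and $\mathcal{F}$ is a nonempty set of functions $f:Q\to\mathbb{Z}$ with $f(0)=0$. A strategy is a sequence of queries $q(1),q(2),\dots$ with $q(t)$ depending on the answers $f(q(1)),\dots,f(q(t-1))$ for the hidden codeword $f$. A reduction of length $T$ from $A=(Q_A,\mathcal{F}_A)$ to a set of games $\mathbf{B}$ is a strategy $(q(t))_{t=1}^T$ for $A$ such that for every answer sequence $\mathbf{a}$ there exist $B=(Q_B,\mathcal{F}_B)\in\mathbf{B}$ and maps $\varphi:Q_B\to Q_A$, $\Phi:\mathcal{F}_B\to\mathcal{F}_A$, depending only on $\mathbf{a}$, with $f'\circ\varphi\in\mathcal{F}_B$ and $\Phi(f'\circ\varphi)=f'$ for every $f'\in\mathcal{F}_A$ consistent with $\mathbf{a}$. A reduction is bounded if there is a function $b(t)=b(t,f(q(1)),\dots,f(q(t-1)))$ with $0\le f(q(t))\le b(t)$ for all $t$ and all codewords $f$; it has weight at most $T$ if $\sum_t(\log_2(b(t)+1))^2\le T$ for every hidden codeword $f$. For a function $r:\{1,2,\dots\}\to\{0,1,2,\dots\}$, a reduction is $r(t)$-bounded if $0\le f(q(t))\le r(t)$ for all $t$ and all codewords $f$. $\mathcal{R}$ is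 the set of functions $r:\{1,2,\dots\}\to\{0,1,2,\dots\}$ for which there is a sequence of integers $a_1,a_2,\dots$ such that $r(t)=2^{2^i}-1$ if $t\equiv a_i\pmod{4^i}$ for some $i\ge1$, and $r(t)=0$ otherwise.
   Formalization: The weight bound $T$ ranges over the positive rationals. -}

module Defs where

open import Data.Nat as ℕ using (ℕ; zero; suc; _^_; _<_)
open import Data.Integer as ℤ using (ℤ; +_; _-_)
open import Data.Integer.Divisibility using () renaming (_∣_ to _∣ℤ_)
open import Data.Rational.Unnormalised as Q using (ℚᵘ; mkℚᵘ; 0ℚᵘ)
open import Data.List using (List; []; _∷_; _++_; [_]; length; map; foldr)
open import Data.List.Relation.Binary.Pointwise using (Pointwise)
open import Data.Product using (Σ; _×_; _,_; ∃)
open import Relation.Binary.PropositionalEquality using (_≡_)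
open import Relation.Nullary using (¬_)

record Game : Set₁ where
  field
    Q        : Set
    zeroQ    : Q
    𝓕        : (Q → ℤ) → Set
    𝓕-zero   : ∀ f → 𝓕 f → f zeroQ ≡ + 0
    nonempty : Σ (Q → ℤ) 𝓕
open Game public

Strategy : Game → Set
Strategy A = List ℤ → Q A

trace : {A : Game} → Strategy A → (Q A → ℤ) → ℕ → List ℤ
trace q f zero    = []
trace {A} q f (suc n) = trace {A} q f n ++ [ f (q (trace {A} q f n)) ]

IsReduction : (A : Game) → (Game → Set) → Strategy A → ℕ → Set₁
IsReduction A 𝐁 q N =
  (as : List ℤ) → length as ≡ N →
  Σ Game λ B → 𝐁 B ×
  Σ (Q B → Q A) λ φ →
  Σ ((Q B → ℤ) → (Q A → ℤ)) λ Φ →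
    (∀ g → 𝓕 B g → 𝓕 A (Φ g)) ×
    (∀ f' → 𝓕 A f' → trace {A} q f' N ≡ as →
       𝓕 B (λ x → f' (φ x)) ×
       (∀ y → Φ (λ x → f' (φ x)) y ≡ f' y))

IsBoundedBy : (A : Game) → Strategy A → ℕ → (List ℤ → ℕ) → Set
IsBoundedBy A q N b =
  ∀ f → 𝓕 A f → ∀ k → k < N →
    (+ 0 ℤ.≤ f (q (trace {A} q f k))) × (f (q (trace {A} q f k)) ℤ.≤ + b (trace {A} q f k))

histories : {A : Game} → Strategy A → (Q A → ℤ) → ℕ → List (List ℤ)
histories q f zero    = []
histories {A} q f (suc n) = histories {A} q f n ++ [ trace {A} q f n ]

-- Rational p / (1 + d).
frac : ℕ → ℕ → ℚᵘ
frac p d = mkℚᵘ (+ p) d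

sumSq : List (ℕ × ℕ) → ℚᵘ
sumSq = foldr (λ { (p , d) s → frac p d Q.* frac p d Q.+ s }) 0ℚᵘ

-- u = p/(1+d) is an upper bound for log₂(b+1), i.e. (b+1)^(1+d) ≤ 2^p.
LogUpper : ℕ → ℕ × ℕ → Set
LogUpper b (p , d) = suc b ^ suc d ℕ.≤ 2 ^ p

-- Σ_t (log₂(b_t + 1))² ≤ T, expressed without reals:
-- for every rational ε > 0 there are rational upper bounds u_t ≥ log₂(b_t+1)
-- with Σ_t u_t² ≤ T + ε.  (Classically equivalent to the real inequality.)
WeightAtMost : List ℕ → ℚᵘ → Set
WeightAtMost bs T =
  ∀ (ε : ℚᵘ) → 0ℚᵘ Q.< ε →
    Σ (List (ℕ × ℕ)) λ us → Pointwise LogUpper bs us × (sumSq us Q.≤ T Q.+ ε)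

HasBoundedReductionOfWeight : Game → (Game → Set) → ℚᵘ → Set₁
HasBoundedReductionOfWeight A 𝐁 T =
  Σ ℕ λ N → Σ (Strategy A) λ q →
    IsReduction A 𝐁 q N ×
    Σ (List ℤ → ℕ) λ b →
      IsBoundedBy A q N b ×
      (∀ f → 𝓕 A f → WeightAtMost (map b (histories {A} q f N)) T)

-- r(t)-bounded: 0 ≤ f(q(t)) ≤ r(t) for t = 1..N (t = k+1).
IsRBounded : (A : Game) → Strategy A → ℕ → (ℕ → ℕ) → Set
IsRBounded A q N r =
  ∀ f → 𝓕 A f → ∀ k → k < N →
    (+ 0 ℤ.≤ f (q (trace {A} q f k))) × (f (q (trace {A} q f k)) ℤ.≤ + r (suc k))

_≡_[mod_] : ℤ → ℤ → ℕ → Set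
x ≡ y [mod m ] = (+ m) ∣ℤ (x - y)

-- The class ℛ (only t ≥ 1 matters; r 0 is unconstrained).
inℛ : (ℕ → ℕ) → Set
inℛ r = Σ (ℕ → ℤ) λ a → ∀ t → 1 ℕ.≤ t →
  (∀ i → 1 ℕ.≤ i → (+ t) ≡ a i [mod 4 ^ i ] → r t ≡ 2 ^ (2 ^ i) ℕ.∸ 1) ×
  ((∀ i → 1 ℕ.≤ i → ¬ ((+ t) ≡ a i [mod 4 ^ i ])) → r t ≡ 0)

module Submission where

-- Replay the given reduction q slowly. Its step with answer bound B is asked only at a time t with
-- t ≡ a_i (mod 4^i), where i = level B satisfies 2^2^(i-1) ≤ B + 1 ≤ 2^2^i, so that r(t) = 2^2^i - 1 ≥ B;
-- at all other times the zero query is asked, whose answer 0 is within any bound, and steps with B = 0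
-- are answered 0 without asking. Such a t comes within 4^i steps, and 4^i ≤ 4 log₂(B + 1)², so after
-- ⌊4T⌋ steps the whole run of q has been replayed.

open import Defs
open import Data.Nat as ℕ using (ℕ; zero; suc; _+_; _*_; _∸_; _^_; _≤_; _<_; z≤n; s≤s)
open import Data.Nat.Properties
open import Data.Nat.Tactic.RingSolver using (solve-∀)
open import Data.List using (List; []; _∷_; _++_; [_]; length; map; applyUpTo; replicate)
open import Data.List.Properties using (length-++; length-replicate; applyUpTo-∷ʳ; map-applyUpTo)
open import Data.Nat.ListAction using (sum)
open import Data.Nat.ListAction.Properties using (sum-++)
open import Data.Nat.DivMod using (_/_; m/n*n≤m; m*n/n≡m; /-monoˡ-≤)
open import Data.Integer as ℤ using (ℤ; +_; -[1+_])
import Data.Integer.Properties as ℤP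
open import Data.Integer.DivMod using (_%ℕ_; _/ℕ_; a≡a%ℕn+[a/ℕn]*n; n%ℕd<d)
import Data.Integer.Tactic.RingSolver as ℤSolver
open import Data.Nat.Divisibility using (divides; _∣?_)
open import Data.Rational.Unnormalised as ℚ using (ℚᵘ; mkℚᵘ; 0ℚᵘ; *≤*; *≡*; _≃_)
import Data.Rational.Unnormalised.Properties as ℚP
open import Data.List.Relation.Binary.Pointwise using (Pointwise; []; _∷_)
open import Data.Product using (Σ; _×_; _,_; proj₁; proj₂)
open import Relation.Nullary using (¬_; Dec; yes; no; contradiction)
open import Relation.Nullary.Decidable using (_×-dec_)
open import Relation.Binary.PropositionalEquality hiding ([_])

square-2^2^ : ∀ j → 2 ^ 2 ^ suc j ≡ 2 ^ 2 ^ j * 2 ^ 2 ^ j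
square-2^2^ j = begin
  2 ^ (2 * 2 ^ j)       ≡⟨ cong (2 ^_) (*-comm 2 (2 ^ j)) ⟩
  2 ^ (2 ^ j * 2)       ≡⟨ ^-*-assoc 2 (2 ^ j) 2 ⟨
  (2 ^ 2 ^ j) ^ 2       ≡⟨ cong (2 ^ 2 ^ j *_) (*-identityʳ (2 ^ 2 ^ j)) ⟩
  2 ^ 2 ^ j * 2 ^ 2 ^ j ∎
  where open ≡-Reasoning

suc-≤-square : ∀ {x} → 2 ≤ x → suc x ≤ x * x
suc-≤-square {x} 2≤x = begin
  1 + x  ≤⟨ +-monoˡ-≤ x (≤-trans (s≤s z≤n) 2≤x) ⟩
  x + x  ≡⟨ cong (λ y → x + y) (+-identityʳ x) ⟨
  2 * x  ≤⟨ *-monoˡ-≤ x 2≤x ⟩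
  x * x  ∎
  where open ≤-Reasoning

2≤2^2^ : ∀ j → 2 ≤ 2 ^ 2 ^ j
2≤2^2^ j = ^-monoʳ-≤ 2 (m^n>0 2 j)

doubleExp-bracket : ∀ n → Σ ℕ λ j → 2 ^ 2 ^ j ≤ 2 + n × 2 + n ≤ 2 ^ 2 ^ suc j
doubleExp-bracket zero = 0 , ≤-refl , s≤s (s≤s z≤n)
doubleExp-bracket (suc n) with doubleExp-bracket n
... | j , lo , hi with 3 + n ℕ.≤? 2 ^ 2 ^ suc j
...   | yes hi′ = j , m≤n⇒m≤1+n lo , hi′
...   | no ¬hi′ = suc j , ≤-trans (≤-reflexive X≡2+n) (n≤1+n (2 + n)) , 3+n≤X*X
  where
  X = 2 ^ 2 ^ suc j
  X≡2+n : X ≡ 2 + n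
  X≡2+n = ≤-antisym (≮⇒≥ ¬hi′) hi
  3+n≤X*X : 3 + n ≤ 2 ^ 2 ^ suc (suc j)
  3+n≤X*X rewrite square-2^2^ (suc j) | sym X≡2+n = suc-≤-square (2≤2^2^ (suc j))

-- level 0 is never consulted: steps whose answer bound is 0 are skipped.
level : ℕ → ℕ
level zero    = 1
level (suc n) = suc (proj₁ (doubleExp-bracket n))

1≤level : ∀ n → 1 ≤ level n
1≤level zero    = s≤s z≤n
1≤level (suc n) = s≤s z≤n

suc-≤-2^2^level : ∀ n → suc n ≤ 2 ^ 2 ^ level n
suc-≤-2^2^level zero    = ≤-trans (s≤s z≤n) (2≤2^2^ 1)
suc-≤-2^2^level (suc n) = proj₂ (proj₂ (doubleExp-bracket n))

weight : ℕ → ℕ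
weight zero        = 0
weight n@(suc _) = 4 ^ level n

weight-nonZero : ∀ {n} → n ≢ 0 → weight n ≡ 4 ^ level n
weight-nonZero {zero}  n≢0 = contradiction refl n≢0
weight-nonZero {suc n} _   = refl

2^m≤2^n⇒m≤n : ∀ {m n} → 2 ^ m ≤ 2 ^ n → m ≤ n
2^m≤2^n⇒m≤n 2^m≤2^n = ≮⇒≥ (λ n<m → <⇒≱ (^-monoʳ-< 2 (s≤s (s≤s z≤n)) n<m) 2^m≤2^n)

4^n≡2^n*2^n : ∀ n → 4 ^ n ≡ 2 ^ n * 2 ^ n
4^n≡2^n*2^n zero    = refl
4^n≡2^n*2^n (suc n) = trans (cong (4 *_) (4^n≡2^n*2^n n)) (square-* (2 ^ n))
  where
  square-* : ∀ x → 4 * (x * x) ≡ (2 * x) * (2 * x)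
  square-* = solve-∀

-- weight n ≤ 4 (p / (d + 1))², with the denominators cleared.
weight-≤ : ∀ n p d → LogUpper n (p , d) → weight n * (suc d * suc d) ≤ 4 * (p * p)
weight-≤ zero    p d _  = z≤n
weight-≤ (suc n) p d lu = begin
  4 * 4 ^ j * (suc d * suc d)        ≡⟨ cong (λ x → 4 * x * (suc d * suc d)) (4^n≡2^n*2^n j) ⟩
  4 * (2 ^ j * 2 ^ j) * (suc d * suc d) ≡⟨ regroup (2 ^ j) (suc d) ⟩
  4 * (2 ^ j * suc d * (2 ^ j * suc d)) ≤⟨ *-monoʳ-≤ 4 (*-mono-≤ 2^j*sd≤p 2^j*sd≤p) ⟩
  4 * (p * p)                        ∎
  where
  open ≤-Reasoning
  j = proj₁ (doubleExp-bracket n)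
  regroup : ∀ x y → 4 * (x * x) * (y * y) ≡ 4 * (x * y * (x * y))
  regroup = solve-∀
  2^j*sd≤p : 2 ^ j * suc d ≤ p
  2^j*sd≤p = 2^m≤2^n⇒m≤n (begin
    2 ^ (2 ^ j * suc d)   ≡⟨ ^-*-assoc 2 (2 ^ j) (suc d) ⟨
    (2 ^ 2 ^ j) ^ suc d   ≤⟨ ^-monoˡ-≤ (suc d) (proj₁ (proj₂ (doubleExp-bracket n))) ⟩
    (2 + n) ^ suc d       ≤⟨ lu ⟩
    2 ^ p                 ∎)

m+suc-n≡o⇒m<o : ∀ {m n o} → m + suc n ≡ o → m < o
m+suc-n≡o⇒m<o {m} m+n≡o = subst (m <_) m+n≡o (m<m+n m (s≤s z≤n))

sumFrom : (ℕ → ℕ) → ℕ → ℕ → ℕ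
sumFrom g zero    m = 0
sumFrom g (suc n) m = g m + sumFrom g n (suc m)

sumFrom-suc : ∀ g n m → sumFrom g (suc n) m ≡ sumFrom g n m + g (m + n)
sumFrom-suc g zero    m = trans (+-identityʳ (g m)) (cong g (sym (+-identityʳ m)))
sumFrom-suc g (suc n) m = begin
  g m + sumFrom g (suc n) (suc m)                ≡⟨ cong (λ s → g m + s) (sumFrom-suc g n (suc m)) ⟩
  g m + (sumFrom g n (suc m) + g (suc m + n))    ≡⟨ +-assoc (g m) _ _ ⟨
  g m + sumFrom g n (suc m) + g (suc m + n)      ≡⟨ cong (λ k → sumFrom g (suc n) m + g k) (+-suc m n) ⟨
  sumFrom g (suc n) m + g (m + suc n)            ∎
  where open ≡-Reasoning

sumFrom-applyUpTo : ∀ g n → sumFrom g n 0 ≡ sum (applyUpTo g n)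
sumFrom-applyUpTo g zero    = refl
sumFrom-applyUpTo g (suc n) = begin
  sumFrom g (suc n) 0                      ≡⟨ sumFrom-suc g n 0 ⟩
  sumFrom g n 0 + g n                      ≡⟨ cong₂ _+_ (sumFrom-applyUpTo g n) (sym (+-identityʳ (g n))) ⟩
  sum (applyUpTo g n) + sum [ g n ]        ≡⟨ sum-++ (applyUpTo g n) [ g n ] ⟨
  sum (applyUpTo g n ++ [ g n ])           ≡⟨ cong sum (applyUpTo-∷ʳ g n) ⟩
  sum (applyUpTo g (suc n))                ∎
  where open ≡-Reasoning

histories≡applyUpTo-trace : ∀ {A} (q : Strategy A) f n → histories {A} q f n ≡ applyUpTo (trace {A} q f) n
histories≡applyUpTo-trace q f zero    = refl
histories≡applyUpTo-trace {A} q f (suc n) =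
  trans (cong (_++ [ trace {A} q f n ]) (histories≡applyUpTo-trace q f n)) (applyUpTo-∷ʳ (trace {A} q f) n)

length-trace : ∀ {A} (q : Strategy A) f n → length (trace {A} q f n) ≡ n
length-trace q f zero    = refl
length-trace {A} q f (suc n) =
  trans (length-++ (trace {A} q f n)) (trans (+-comm _ 1) (cong suc (length-trace q f n)))

fromℕ : ℕ → ℚᵘ
fromℕ n = mkℚᵘ (+ n) 0

4ℚ : ℚᵘ
4ℚ = fromℕ 4

fromℕ-+ : ∀ m n → fromℕ (m + n) ≃ fromℕ m ℚ.+ fromℕ n
fromℕ-+ m n = *≡* (begin
  + (m + n) ℤ.* + 1                      ≡⟨ ℤP.*-identityʳ (+ (m + n)) ⟩
  + m ℤ.+ + n                            ≡⟨ cong₂ ℤ._+_ (ℤP.*-identityʳ (+ m)) (ℤP.*-identityʳ (+ n)) ⟨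
  + m ℤ.* + 1 ℤ.+ + n ℤ.* + 1            ≡⟨ ℤP.*-identityʳ _ ⟨
  (+ m ℤ.* + 1 ℤ.+ + n ℤ.* + 1) ℤ.* + 1  ∎)
  where open ≡-Reasoning

fromℕ-≤-4*frac² : ∀ x p d → x * (suc d * suc d) ≤ 4 * (p * p) →
                  fromℕ x ℚ.≤ 4ℚ ℚ.* (frac p d ℚ.* frac p d)
fromℕ-≤-4*frac² x p d h = *≤* (subst₂ ℤ._≤_ lhs rhs (ℤ.+≤+ h))
  where
  lhs : + (x * (suc d * suc d)) ≡ + x ℤ.* + (1 * (suc d * suc d))
  lhs = trans (cong (λ y → + (x * y)) (sym (*-identityˡ _))) (ℤP.pos-* x _)
  rhs : + (4 * (p * p)) ≡ + 4 ℤ.* (+ p ℤ.* + p) ℤ.* + 1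
  rhs = begin
    + (4 * (p * p))              ≡⟨ ℤP.pos-* 4 (p * p) ⟩
    + 4 ℤ.* + (p * p)            ≡⟨ cong (+ 4 ℤ.*_) (ℤP.pos-* p p) ⟩
    + 4 ℤ.* (+ p ℤ.* + p)        ≡⟨ ℤP.*-identityʳ _ ⟨
    + 4 ℤ.* (+ p ℤ.* + p) ℤ.* + 1 ∎
    where open ≡-Reasoning

sum-weight-≤-4*sumSq : ∀ {ns us} → Pointwise LogUpper ns us →
                       fromℕ (sum (map weight ns)) ℚ.≤ 4ℚ ℚ.* sumSq us
sum-weight-≤-4*sumSq [] = *≤* (ℤ.+≤+ z≤n)
sum-weight-≤-4*sumSq {n ∷ ns} {(p , d) ∷ us} (lu ∷ lus) = begin
  fromℕ (weight n + sum (map weight ns))            ≃⟨ fromℕ-+ (weight n) _ ⟩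
  fromℕ (weight n) ℚ.+ fromℕ (sum (map weight ns))  ≤⟨ ℚP.+-mono-≤ head-≤ (sum-weight-≤-4*sumSq lus) ⟩
  4ℚ ℚ.* u² ℚ.+ 4ℚ ℚ.* sumSq us                     ≃⟨ ℚP.*-distribˡ-+ 4ℚ u² (sumSq us) ⟨
  4ℚ ℚ.* sumSq ((p , d) ∷ us)                       ∎
  where
  open ℚP.≤-Reasoning
  u² = frac p d ℚ.* frac p d
  head-≤ : fromℕ (weight n) ℚ.≤ 4ℚ ℚ.* u²
  head-≤ = fromℕ-≤-4*frac² (weight n) p d (weight-≤ n p d lu)

≤+ε⇒≤ : ∀ {p q} → (∀ ε → 0ℚᵘ ℚ.< ε → p ℚ.≤ q ℚ.+ ε) → p ℚ.≤ q
≤+ε⇒≤ {p} {q} h with p ℚP.≤? q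
... | yes p≤q = p≤q
... | no  p≰q =
  contradiction (ℚP.≤-<-trans (ℚP.≤-respʳ-≃ q+[ρ-q]≃ρ (h (ρ ℚ.- q) 0<ρ-q)) ρ<p) (ℚP.<-irrefl ℚP.≃-refl)
  where
  q<ρ<p = ℚP.<-dense (ℚP.≰⇒> p≰q)
  ρ = proj₁ q<ρ<p
  ρ<p = proj₂ (proj₂ q<ρ<p)
  0<ρ-q : 0ℚᵘ ℚ.< ρ ℚ.- q
  0<ρ-q = ℚP.<-respˡ-≃ (ℚP.+-inverseʳ q) (ℚP.+-monoˡ-< (ℚ.- q) (proj₁ (proj₂ q<ρ<p)))
  q+[ρ-q]≃ρ : q ℚ.+ (ρ ℚ.- q) ≃ ρ
  q+[ρ-q]≃ρ = begin-equality
    q ℚ.+ (ρ ℚ.- q)        ≃⟨ ℚP.+-comm q (ρ ℚ.- q) ⟩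
    ρ ℚ.- q ℚ.+ q          ≃⟨ ℚP.+-assoc ρ (ℚ.- q) q ⟩
    ρ ℚ.+ (ℚ.- q ℚ.+ q)    ≃⟨ ℚP.+-congʳ ρ (ℚP.+-inverseˡ q) ⟩
    ρ ℚ.+ 0ℚᵘ              ≃⟨ ℚP.+-identityʳ ρ ⟩
    ρ                      ∎
    where open ℚP.≤-Reasoning

sum-weight-≤-4* : ∀ {ns T} → WeightAtMost ns T → fromℕ (sum (map weight ns)) ℚ.≤ 4ℚ ℚ.* T
sum-weight-≤-4* {ns} {T} weightAtMost = ≤+ε⇒≤ within-ε
  where
  ¼ : ℚᵘ
  ¼ = mkℚᵘ (+ 1) 3
  within-ε : ∀ ε → 0ℚᵘ ℚ.< ε → fromℕ (sum (map weight ns)) ℚ.≤ 4ℚ ℚ.* T ℚ.+ ε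
  within-ε ε ε>0 with weightAtMost (¼ ℚ.* ε) (ℚP.<-respˡ-≃ (ℚP.*-zeroʳ ¼) (ℚP.*-monoʳ-<-pos ¼ ε>0))
  ... | us , lus , sumSq≤ = begin
    fromℕ (sum (map weight ns))          ≤⟨ sum-weight-≤-4*sumSq lus ⟩
    4ℚ ℚ.* sumSq us                      ≤⟨ ℚP.*-monoʳ-≤-nonNeg 4ℚ sumSq≤ ⟩
    4ℚ ℚ.* (T ℚ.+ ¼ ℚ.* ε)               ≃⟨ ℚP.*-distribˡ-+ 4ℚ T (¼ ℚ.* ε) ⟩
    4ℚ ℚ.* T ℚ.+ 4ℚ ℚ.* (¼ ℚ.* ε)        ≃⟨ ℚP.+-congʳ (4ℚ ℚ.* T) 4¼ε≃ε ⟩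
    4ℚ ℚ.* T ℚ.+ ε                       ∎
    where
    open ℚP.≤-Reasoning
    4*¼≃1 : 4ℚ ℚ.* ¼ ≃ ℚ.1ℚᵘ
    4*¼≃1 = *≡* refl
    4¼ε≃ε : 4ℚ ℚ.* (¼ ℚ.* ε) ≃ ε
    4¼ε≃ε = begin-equality
      4ℚ ℚ.* (¼ ℚ.* ε)   ≃⟨ ℚP.*-assoc 4ℚ ¼ ε ⟨
      4ℚ ℚ.* ¼ ℚ.* ε     ≃⟨ ℚP.*-congʳ {ε} 4*¼≃1 ⟩
      ℚ.1ℚᵘ ℚ.* ε        ≃⟨ ℚP.*-identityˡ ε ⟩
      ε                  ∎

floor-nonNeg : ∀ x → 0ℚᵘ ℚ.≤ x → Σ ℕ λ L → fromℕ L ℚ.≤ x × (∀ n → fromℕ n ℚ.≤ x → n ≤ L)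
floor-nonNeg (mkℚᵘ -[1+ _ ] _) (*≤* ())
floor-nonNeg (mkℚᵘ (+ n) d) _ = n / suc d , below , greatest
  where
  below : fromℕ (n / suc d) ℚ.≤ mkℚᵘ (+ n) d
  below = *≤* (subst₂ ℤ._≤_ (ℤP.pos-* (n / suc d) (suc d)) (sym (ℤP.*-identityʳ (+ n)))
                            (ℤ.+≤+ (m/n*n≤m n (suc d))))
  greatest : ∀ m → fromℕ m ℚ.≤ mkℚᵘ (+ n) d → m ≤ n / suc d
  greatest m m≤x = subst (_≤ n / suc d) (m*n/n≡m m (suc d)) (/-monoˡ-≤ (suc d) (ℤP.drop‿+≤+ m*sd≤n))
    where
    m*sd≤n : + (m * suc d) ℤ.≤ + n
    m*sd≤n = subst₂ ℤ._≤_ (sym (ℤP.pos-* m (suc d))) (ℤP.*-identityʳ (+ n)) (ℚP.drop-*≤* m≤x)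

residue-in-window : ∀ c M .{{_ : ℕ.NonZero M}} s → Σ ℕ λ d → d < M × (+ (d + s)) ≡ c [mod M ]
residue-in-window c M s = d , n%ℕd<d (c ℤ.- + s) M , divides ℤ.∣ k ∣ ∣d+s-c∣≡∣k∣*M
  where
  d = (c ℤ.- + s) %ℕ M
  k = (c ℤ.- + s) /ℕ M
  c-[d+s]≡k*M : c ℤ.- + (d + s) ≡ k ℤ.* + M
  c-[d+s]≡k*M = begin
    c ℤ.- + (d + s)               ≡⟨ cong (λ x → c ℤ.- x) (ℤP.pos-+ d s) ⟩
    c ℤ.- (+ d ℤ.+ + s)           ≡⟨ minus-+ c (+ s) (+ d) ⟩
    (c ℤ.- + s) ℤ.- + d           ≡⟨ cong (ℤ._- + d) (a≡a%ℕn+[a/ℕn]*n (c ℤ.- + s) M) ⟩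
    (+ d ℤ.+ k ℤ.* + M) ℤ.- + d   ≡⟨ plus-minus (+ d) (k ℤ.* + M) ⟩
    k ℤ.* + M                     ∎
    where
    open ≡-Reasoning
    minus-+ : ∀ x y z → x ℤ.- (z ℤ.+ y) ≡ (x ℤ.- y) ℤ.- z
    minus-+ = ℤSolver.solve-∀
    plus-minus : ∀ x y → (x ℤ.+ y) ℤ.- x ≡ y
    plus-minus = ℤSolver.solve-∀
  ∣d+s-c∣≡∣k∣*M : ℤ.∣ + (d + s) ℤ.- c ∣ ≡ ℤ.∣ k ∣ * M
  ∣d+s-c∣≡∣k∣*M = begin
    ℤ.∣ + (d + s) ℤ.- c ∣    ≡⟨ ℤP.∣i-j∣≡∣j-i∣ (+ (d + s)) c ⟩
    ℤ.∣ c ℤ.- + (d + s) ∣    ≡⟨ cong ℤ.∣_∣ c-[d+s]≡k*M ⟩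
    ℤ.∣ k ℤ.* + M ∣          ≡⟨ ℤP.abs-* k (+ M) ⟩
    ℤ.∣ k ∣ * M              ∎
    where open ≡-Reasoning

module Simulation (A : Game) (q : Strategy A) (N : ℕ) (b : List ℤ → ℕ) (a : ℕ → ℤ) where

  InSlot : ℕ → ℕ → Set
  InSlot i t = (+ t) ≡ a i [mod 4 ^ i ]

  inSlot? : ∀ i t → Dec (InSlot i t)
  inSlot? i t = 4 ^ i ∣? ℤ.∣ + t ℤ.- a i ∣

  skipZeros : ℕ → List ℤ → List ℤ
  skipZeros zero    h = h
  skipZeros (suc n) h with b h ℕ.≟ 0
  ... | yes _ = skipZeros n (h ++ [ + 0 ])
  ... | no  _ = h

  normalize : List ℤ → List ℤ
  normalize h = skipZeros (N ∸ length h) h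

  -- t counts the queries asked so far, so the current time is suc t.
  Active : ℕ → List ℤ → Set
  Active t h = length h < N × InSlot (level (b h)) (suc t)

  active? : ∀ t h → Dec (Active t h)
  active? t h = (length h ℕ.<? N) ×-dec inSlot? (level (b h)) (suc t)

  query : ℕ → List ℤ → Q A
  query t h with active? t h
  ... | yes _ = q h
  ... | no  _ = zeroQ A

  advance : ℕ → List ℤ → ℤ → List ℤ
  advance t h x with active? t h
  ... | yes _ = normalize (h ++ [ x ])
  ... | no  _ = h

  run : ℕ → List ℤ → List ℤ → List ℤ
  run t h []       = h
  run t h (x ∷ xs) = run (suc t) (advance t h x) xs

  simulate : List ℤ → List ℤ
  simulate = run 0 (normalize [])

  strategy : Strategy A
  strategy as = query (length as) (simulate as)

  run-∷ʳ : ∀ t h xs x → run t h (xs ++ [ x ]) ≡ advance (t + length xs) (run t h xs) x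
  run-∷ʳ t h []       x = cong (λ s → advance s h x) (sym (+-identityʳ t))
  run-∷ʳ t h (y ∷ xs) x =
    trans (run-∷ʳ (suc t) (advance t h y) xs x)
          (cong (λ s → advance s (run (suc t) (advance t h y) xs) x) (sym (+-suc t (length xs))))

  advance-active : ∀ {t h} x → Active t h → advance t h x ≡ normalize (h ++ [ x ])
  advance-active {t} {h} x act with active? t h
  ... | yes _    = refl
  ... | no  ¬act = contradiction act ¬act

  advance-inactive : ∀ {t h} x → ¬ Active t h → advance t h x ≡ h
  advance-inactive {t} {h} x ¬act with active? t h
  ... | yes act = contradiction act ¬act
  ... | no  _   = refl

  query-active : ∀ {t h} → Active t h → query t h ≡ q h
  query-active {t} {h} act with active? t h
  ... | yes _    = refl
  ... | no  ¬act = contradiction act ¬act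

  RespectsSlots : (ℕ → ℕ) → Set
  RespectsSlots r = ∀ {i t} → 1 ≤ i → InSlot i (suc t) → r (suc t) ≡ 2 ^ 2 ^ i ∸ 1

  weightAlong : (Q A → ℤ) → ℕ → ℕ
  weightAlong f m = weight (b (trace {A} q f m))

  module Play (f : Q A → ℤ) where

    tr : ℕ → List ℤ
    tr = trace {A} q f

    sim : ℕ → List ℤ
    sim k = simulate (trace {A} strategy f k)

    sim-suc : ∀ k → sim (suc k) ≡ advance k (sim k) (f (query k (sim k)))
    sim-suc k = begin
      sim (suc k)                              ≡⟨ run-∷ʳ 0 (normalize []) past _ ⟩
      step (length past)                       ≡⟨ cong step (length-trace strategy f k) ⟩
      advance k (sim k) (f (query k (sim k)))  ∎
      where
      open ≡-Reasoning
      past = trace {A} strategy f k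
      step : ℕ → List ℤ
      step t = advance t (sim k) (f (query t (sim k)))

    sim-active : ∀ k {h} → sim k ≡ h → Active k h → sim (suc k) ≡ normalize (h ++ [ f (q h) ])
    sim-active k {h} sim≡h act = begin
      sim (suc k)                              ≡⟨ sim-suc k ⟩
      advance k (sim k) (f (query k (sim k)))  ≡⟨ cong (λ h′ → advance k h′ (f (query k h′))) sim≡h ⟩
      advance k h (f (query k h))              ≡⟨ advance-active _ act ⟩
      normalize (h ++ [ f (query k h) ])       ≡⟨ cong (λ x → normalize (h ++ [ f x ])) (query-active act) ⟩
      normalize (h ++ [ f (q h) ])             ∎
      where open ≡-Reasoning

    sim-inactive : ∀ k {h} → sim k ≡ h → ¬ Active k h → sim (suc k) ≡ h
    sim-inactive k {h} sim≡h ¬act = begin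
      sim (suc k)                              ≡⟨ sim-suc k ⟩
      advance k (sim k) (f (query k (sim k)))  ≡⟨ cong (λ h′ → advance k h′ (f (query k h′))) sim≡h ⟩
      advance k h (f (query k h))              ≡⟨ advance-inactive _ ¬act ⟩
      h                                        ∎
      where open ≡-Reasoning

    active⇒<N : ∀ {k m} → Active k (tr m) → m < N
    active⇒<N {k} {m} act = subst (_< N) (length-trace q f m) (proj₁ act)

    normalize-trace : ∀ m {n} → m + n ≡ N → normalize (tr m) ≡ skipZeros n (tr m)
    normalize-trace m {n} m+n≡N = cong (λ l → skipZeros l (tr m)) (begin
      N ∸ length (tr m)  ≡⟨ cong₂ _∸_ (sym m+n≡N) (length-trace q f m) ⟩
      m + n ∸ m          ≡⟨ m+n∸m≡n m n ⟩
      n                  ∎)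
      where open ≡-Reasoning

    finished-step : ∀ k → sim k ≡ tr N → sim (suc k) ≡ tr N
    finished-step k sim≡trN = sim-inactive k sim≡trN (λ act → <-irrefl refl (active⇒<N act))

    stays-finished : ∀ {k k′} → k ≤ k′ → sim k ≡ tr N → sim k′ ≡ tr N
    stays-finished {k} {k′} k≤k′ sim≡trN = subst (λ j → sim j ≡ tr N) (m∸n+n≡m k≤k′) (after (k′ ∸ k))
      where
      after : ∀ d → sim (d + k) ≡ tr N
      after zero    = sim≡trN
      after (suc d) = finished-step (d + k) (after d)

    waits-for-slot : ∀ {m} d k → sim k ≡ tr m → m < N → InSlot (level (b (tr m))) (d + suc k) →
                     Σ ℕ λ d′ → d′ ≤ d × sim (d′ + suc k) ≡ normalize (tr (suc m))
    waits-for-slot {m} d k sim≡trm m<N slot with active? k (tr m)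
    ... | yes act = 0 , z≤n , sim-active k sim≡trm act
    waits-for-slot {m} zero    k sim≡trm m<N slot | no ¬act =
      contradiction (subst (_< N) (sym (length-trace q f m)) m<N , slot) ¬act
    waits-for-slot {m} (suc d) k sim≡trm m<N slot | no ¬act
      with waits-for-slot d (suc k) (sim-inactive k sim≡trm ¬act) m<N (subst (InSlot _) (sym (+-suc d (suc k))) slot)
    ... | d′ , d′≤d , reached =
      suc d′ , s≤s d′≤d , subst (λ t → sim t ≡ normalize (tr (suc m))) (+-suc d′ (suc k)) reached

    module _ (bounded : ∀ m → m < N → (+ 0 ℤ.≤ f (q (tr m))) × (f (q (tr m)) ℤ.≤ + b (tr m))) where

      answer-zero : ∀ {m} → m < N → b (tr m) ≡ 0 → f (q (tr m)) ≡ + 0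
      answer-zero {m} m<N b≡0 =
        ℤP.≤-antisym (subst (λ B → f (q (tr m)) ℤ.≤ + B) b≡0 (proj₂ (bounded m m<N)))
                     (proj₁ (bounded m m<N))

      skip-answer-zero : ∀ n {m} → m < N → b (tr m) ≡ 0 →
                         skipZeros n (tr m ++ [ + 0 ]) ≡ skipZeros n (tr (suc m))
      skip-answer-zero n {m} m<N b≡0 = cong (λ x → skipZeros n (tr m ++ [ x ])) (sym (answer-zero m<N b≡0))

      skipZeros-trace : ∀ n m → m + n ≡ N → Σ ℕ λ m′ → skipZeros n (tr m) ≡ tr m′
      skipZeros-trace zero    m _ = m , refl
      skipZeros-trace (suc n) m m+n≡N with b (tr m) ℕ.≟ 0
      ... | no  _   = m , refl
      ... | yes b≡0 with skipZeros-trace n (suc m) (trans (sym (+-suc m n)) m+n≡N)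
      ...   | m′ , skip≡ = m′ , trans (skip-answer-zero n (m+suc-n≡o⇒m<o m+n≡N) b≡0) skip≡

      sim-trace : ∀ k → Σ ℕ λ m → sim k ≡ tr m
      sim-trace zero = skipZeros-trace N 0 refl
      sim-trace (suc k) with sim-trace k
      ... | m , sim≡trm with active? k (tr m)
      ...   | no ¬act = m , sim-inactive k sim≡trm ¬act
      ...   | yes act with skipZeros-trace (N ∸ suc m) (suc m) (m+[n∸m]≡n (active⇒<N act))
      ...     | m′ , skip≡ =
        m′ , trans (sim-active k sim≡trm act) (trans (normalize-trace (suc m) (m+[n∸m]≡n (active⇒<N act))) skip≡)

      finishes : ∀ n m k → m + n ≡ N → sim k ≡ skipZeros n (tr m) →
                 sim (k + sumFrom (weightAlong f) n m) ≡ tr N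
      finishes zero m k m+0≡N sim≡ =
        subst₂ (λ t j → sim t ≡ tr j) (sym (+-identityʳ k)) (trans (sym (+-identityʳ m)) m+0≡N) sim≡
      finishes (suc n) m k m+n≡N sim≡ with b (tr m) ℕ.≟ 0
      ... | yes b≡0 =
        subst (λ w → sim (k + (w + sumFrom (weightAlong f) n (suc m))) ≡ tr N) (sym (cong weight b≡0))
          (finishes n (suc m) k sm+n≡N (trans sim≡ (skip-answer-zero n m<N b≡0)))
        where
        m<N = m+suc-n≡o⇒m<o m+n≡N
        sm+n≡N = trans (sym (+-suc m n)) m+n≡N
      ... | no b≢0
            with residue-in-window (a (level (b (tr m)))) (4 ^ level (b (tr m))) {{m^n≢0 4 (level (b (tr m)))}} (suc k)
      ...   | d , d<4^i , slot
            with waits-for-slot d k sim≡ (m+suc-n≡o⇒m<o m+n≡N) slot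
      ...     | d′ , d′≤d , reached = stays-finished on-time (finishes n (suc m) (d′ + suc k) sm+n≡N next)
        where
        open ≤-Reasoning
        sm+n≡N = trans (sym (+-suc m n)) m+n≡N
        next : sim (d′ + suc k) ≡ skipZeros n (tr (suc m))
        next = trans reached (normalize-trace (suc m) sm+n≡N)
        W = sumFrom (weightAlong f) n (suc m)
        on-time : d′ + suc k + W ≤ k + (weightAlong f m + W)
        on-time = begin
          d′ + suc k + W          ≡⟨ cong (_+ W) (trans (+-suc d′ k) (+-comm (suc d′) k)) ⟩
          k + suc d′ + W          ≤⟨ +-monoˡ-≤ W (+-monoʳ-≤ k (≤-trans (s≤s d′≤d) d<4^i)) ⟩
          k + 4 ^ level (b (tr m)) + W    ≡⟨ +-assoc k (4 ^ level (b (tr m))) W ⟩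
          k + (4 ^ level (b (tr m)) + W)  ≡⟨ cong (λ w → k + (w + W)) (weight-nonZero b≢0) ⟨
          k + (weightAlong f m + W) ∎

      finished-by : ∀ {k} → sumFrom (weightAlong f) N 0 ≤ k → sim k ≡ tr N
      finished-by le = stays-finished le (finishes N 0 0 refl refl)

      answer-within-r : ∀ r → RespectsSlots r → f (zeroQ A) ≡ + 0 → ∀ k m →
                        (+ 0 ℤ.≤ f (query k (tr m))) × (f (query k (tr m)) ℤ.≤ + r (suc k))
      answer-within-r r r-on-slots f0≡0 k m with active? k (tr m)
      ... | no  _ rewrite f0≡0 = ℤ.+≤+ z≤n , ℤ.+≤+ z≤n
      ... | yes act@(_ , slot) with bounded m (active⇒<N act)
      ...   | 0≤answer , answer≤b = 0≤answer , ℤP.≤-trans answer≤b (ℤ.+≤+ b≤r)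
        where
        b≤r : b (tr m) ≤ r (suc k)
        b≤r = subst (b (tr m) ≤_) (sym (r-on-slots {t = k} (1≤level (b (tr m))) slot))
                (suc[m]≤n⇒m≤pred[n] (suc-≤-2^2^level (b (tr m))))

  weightAlong-total : ∀ f → sumFrom (weightAlong f) N 0 ≡ sum (map weight (map b (histories {A} q f N)))
  weightAlong-total f = begin
    sumFrom (weightAlong f) N 0                      ≡⟨ sumFrom-applyUpTo (weightAlong f) N ⟩
    sum (applyUpTo (weightAlong f) N)                ≡⟨ cong sum (map-applyUpTo (λ m → b (tr m)) weight N) ⟨
    sum (map weight (applyUpTo (λ m → b (tr m)) N))  ≡⟨ cong (λ hs → sum (map weight hs)) (map-applyUpTo tr b N) ⟨
    sum (map weight (map b (applyUpTo tr N)))        ≡⟨ cong (λ hs → sum (map weight (map b hs)))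
                                                             (histories≡applyUpTo-trace q f N) ⟨
    sum (map weight (map b (histories {A} q f N)))   ∎
    where
    open ≡-Reasoning
    tr = trace {A} q f

  strategy-isRBounded : IsBoundedBy A q N b → ∀ r → RespectsSlots r → ∀ L → IsRBounded A strategy L r
  strategy-isRBounded bounded r r-on-slots L f f∈𝓕 k _ with Play.sim-trace f (bounded f f∈𝓕) k
  ... | m , sim≡trm =
    subst₂ (λ t h → (+ 0 ℤ.≤ f (query t h)) × (f (query t h) ℤ.≤ + r (suc k)))
           (sym (length-trace strategy f k)) (sym sim≡trm)
           (Play.answer-within-r f (bounded f f∈𝓕) r r-on-slots (𝓕-zero A f f∈𝓕) k m)

  replays : IsBoundedBy A q N b → ∀ {L} f → 𝓕 A f → sumFrom (weightAlong f) N 0 ≤ L →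
            simulate (trace {A} strategy f L) ≡ trace {A} q f N
  replays bounded f f∈𝓕 = Play.finished-by f (bounded f f∈𝓕)

  strategy-isReduction : ∀ {𝐁} → IsBoundedBy A q N b → IsReduction A 𝐁 q N → ∀ L →
                         (∀ f → 𝓕 A f → sumFrom (weightAlong f) N 0 ≤ L) → IsReduction A 𝐁 strategy L
  strategy-isReduction bounded reduction L on-time as _ with length (simulate as) ℕ.≟ N
  ... | yes len≡N with reduction (simulate as) len≡N
  ...   | B , B∈𝐁 , φ , Φ , Φ-into , consistent =
    B , B∈𝐁 , φ , Φ , Φ-into , λ f f∈𝓕 trace≡as →
      consistent f f∈𝓕 (trans (sym (replays bounded f f∈𝓕 (on-time f f∈𝓕))) (cong simulate trace≡as))
  -- No codeword produces the answers as, so any target game will do.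
  strategy-isReduction bounded reduction L on-time as _ | no len≢N
    with reduction (replicate N (+ 0)) (length-replicate N)
  ...   | B , B∈𝐁 , φ , Φ , Φ-into , _ =
    B , B∈𝐁 , φ , Φ , Φ-into , λ f f∈𝓕 trace≡as →
      contradiction (length-simulate f f∈𝓕 trace≡as) len≢N
    where
    length-simulate : ∀ f → 𝓕 A f → trace {A} strategy f L ≡ as → length (simulate as) ≡ N
    length-simulate f f∈𝓕 trace≡as = begin
      length (simulate as)                         ≡⟨ cong (λ xs → length (simulate xs)) trace≡as ⟨
      length (simulate (trace {A} strategy f L))   ≡⟨ cong length (replays bounded f f∈𝓕 (on-time f f∈𝓕)) ⟩
      length (trace {A} q f N)                     ≡⟨ length-trace q f N ⟩
      N                                            ∎
      where open ≡-Reasoning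

proposition11 : (A : Game) (𝐁 : Game → Set) (T : ℚᵘ) → 0ℚᵘ ℚ.< T →
    HasBoundedReductionOfWeight A 𝐁 T →
    (r : ℕ → ℕ) → inℛ r →
    Σ ℕ λ L → Σ (Strategy A) λ q →
      (mkℚᵘ (+ L) 0 ℚ.≤ mkℚᵘ (+ 4) 0 ℚ.* T) × IsReduction A 𝐁 q L × IsRBounded A q L r
proposition11 A 𝐁 T T>0 (N , q , reduction , b , bounded , weightAtMost) r (a , r∈ℛ) =
  L , strategy , L≤4T ,
  strategy-isReduction bounded reduction L on-time , strategy-isRBounded bounded r r-on-slots L
  where
  open Simulation A q N b a
  0≤4T : 0ℚᵘ ℚ.≤ 4ℚ ℚ.* T
  0≤4T = ℚP.≤-respˡ-≃ (ℚP.*-zeroʳ 4ℚ) (ℚP.*-monoʳ-≤-nonNeg 4ℚ (ℚP.<⇒≤ T>0))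
  ⌊4T⌋ = floor-nonNeg (4ℚ ℚ.* T) 0≤4T
  L = proj₁ ⌊4T⌋
  L≤4T = proj₁ (proj₂ ⌊4T⌋)
  on-time : ∀ f → 𝓕 A f → sumFrom (weightAlong f) N 0 ≤ L
  on-time f f∈𝓕 = proj₂ (proj₂ ⌊4T⌋) _ (subst (λ w → fromℕ w ℚ.≤ 4ℚ ℚ.* T) (sym (weightAlong-total f))
                                               (sum-weight-≤-4* {T = T} (weightAtMost f f∈𝓕)))
  r-on-slots : RespectsSlots r
  r-on-slots {i} {t} 1≤i slot = proj₁ (r∈ℛ (suc t) (s≤s z≤n)) i 1≤i slot
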